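{- Let $C_1$ be a binary self-dual code of length $n$ with covering radius $\rho(C_1)$. Then any binary self-dual code $C_2$ of length $n+2$ obtained from $C_1$ by the building-up construction has covering radius $\rho(C_2)\le \rho(C_1)+2$.
   Context: A binary code is self-dual if $C=C^\perp$ under the standard inner product. The covering radius $\rho(C)$ of $C\subseteq GF(2)^n$ is the smallest $R$ such that Hamming balls of radius $R$ around codewords cover $GF(2)^n$. Building-up construction: let $G_0$ be a generator matrix of the self-dual code $C_1$ with rows $\mathbf r_1,\dots,\mathbf r_{n/2}$, let $\mathbf x\in GF(2)^n$ have odd weight, and set $y_i=\mathbf x\cdot\mathbf r_i$. The code obtained is the (self-dual, length $n+2$) code generated by the matrix whose first row is $(1,0,\mathbf x)$ and whose remaining rows are $(y_i,y_i,\mathbf r_i)$ for $1\le i\le n/2$. -}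

module Defs where

open import Data.Bool using (Bool; true; false; _xor_; _∧_)
open import Data.Nat using (ℕ; zero; suc; _+_; _≤_)
open import Data.Vec using (Vec; []; _∷_; zipWith; replicate; map; foldr; count)
open import Data.Product using (Σ; ∃; _×_; _,_)
open import Relation.Binary.PropositionalEquality using (_≡_)
open import Data.Bool using (T?)

-- binary words of length n (elements of GF(2)^n); xor = addition, ∧ = multiplication
Word : ℕ → Set
Word n = Vec Bool n

Code : ℕ → Set₁
Code n = Word n → Set

_⊕_ : {n : ℕ} → Word n → Word n → Word n
_⊕_ = zipWith _xor_

zeroWord : (n : ℕ) → Word n
zeroWord n = replicate n false

_·_ : {n : ℕ} → Word n → Word n → Bool
u · v = foldr _ _xor_ false (zipWith _∧_ u v)

wt : {n : ℕ} → Word n → ℕ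
wt = count T?

dist : {n : ℕ} → Word n → Word n → ℕ
dist u v = wt (u ⊕ v)

lincomb : {k n : ℕ} → Vec Bool k → Vec (Word n) k → Word n
lincomb {n = n} []       []       = zeroWord n
lincomb {n = n} (a ∷ as) (r ∷ rs) = scale a r ⊕ lincomb as rs
  where
  scale : Bool → Word n → Word n
  scale b w = map (b ∧_) w

Span : {k n : ℕ} → Vec (Word n) k → Code n
Span G w = Σ (Vec Bool _) λ a → w ≡ lincomb a G

Dual : {n : ℕ} → Code n → Code n
Dual C w = ∀ c → C c → w · c ≡ false

SelfDual : {n : ℕ} → Code n → Set
SelfDual C = ∀ w → (C w → Dual C w) × (Dual C w → C w)

CoversWithin : {n : ℕ} → Code n → ℕ → Set
CoversWithin C R = ∀ v → Σ _ λ c → C c × dist v c ≤ R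

IsCoveringRadius : {n : ℕ} → Code n → ℕ → Set
IsCoveringRadius C ρ = CoversWithin C ρ × (∀ R → CoversWithin C R → ρ ≤ R)

buildUp : {k n : ℕ} → Vec (Word n) k → Word n → Vec (Word (suc (suc n))) (suc k)
buildUp G₀ x = (true ∷ false ∷ x) ∷ map (λ r → (x · r) ∷ (x · r) ∷ r) G₀

module Submission where

-- Let C₁ = Span G₀ and C₂ = Span (buildUp G₀ x).  The rows of buildUp G₀ x
-- other than the first are the rows r of G₀ with the two coordinates
-- x · r, x · r adjoined in front.  Hence, using only those rows, every
-- codeword c of C₁ lifts to a codeword (y, y, c) of C₂ for some bit y.
-- Given any word (a, b, v) of length n + 2, pick c ∈ C₁ within distance R
-- of v; its lift lies within distance R + 2 of (a, b, v), since only the two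
-- new coordinates can add to the distance.  So C₂ is covered within
-- ρ(C₁) + 2, and minimality of ρ(C₂) gives ρ(C₂) ≤ ρ(C₁) + 2.

open import Defs
open import Data.Nat using (ℕ; suc; _+_; _≤_; _%_; s≤s)
open import Data.Nat.Properties using (≤-refl; ≤-trans; ≤-reflexive; n≤1+n; +-comm; +-monoˡ-≤)
open import Data.Bool using (Bool; true; false; _xor_; _∧_)
open import Data.Vec using (Vec; []; _∷_; map; zipWith)
open import Data.Product using (Σ; _,_)
open import Relation.Binary.PropositionalEquality using (_≡_; refl; sym; cong)
open Relation.Binary.PropositionalEquality.≡-Reasoning

false-scaled-⊕ : ∀ {n} (r w : Word n) → map (false ∧_) r ⊕ w ≡ w
false-scaled-⊕ []      []       = refl
false-scaled-⊕ (_ ∷ r) (b ∷ w) = cong (b ∷_) (false-scaled-⊕ r w)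

lincomb-false : ∀ {k n} (α : Vec Bool k) (r : Word n) (G : Vec (Word n) k) →
                lincomb (false ∷ α) (r ∷ G) ≡ lincomb α G
lincomb-false α r G = false-scaled-⊕ r (lincomb α G)

lincomb-adjoin : ∀ {k n} (α : Vec Bool k) (col : Vec Bool k) (G : Vec (Word n) k) →
                 lincomb α (zipWith _∷_ col G) ≡ (α · col) ∷ lincomb α G
lincomb-adjoin []       []         []       = refl
lincomb-adjoin (a ∷ α) (c ∷ col) (r ∷ G) rewrite lincomb-adjoin α col G = refl

wt-cons : ∀ {n} (b : Bool) (w : Word n) → wt (b ∷ w) ≤ suc (wt w)
wt-cons true  w = ≤-refl
wt-cons false w = n≤1+n _

dist-prefix₂ : ∀ {n} (a b c d : Bool) (u w : Word n) →
               dist (a ∷ b ∷ u) (c ∷ d ∷ w) ≤ dist u w + 2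
dist-prefix₂ a b c d u w =
  ≤-trans (wt-cons (a xor c) ((b xor d) ∷ (u ⊕ w)))
    (≤-trans (s≤s (wt-cons (b xor d) (u ⊕ w)))
             (≤-reflexive (+-comm 2 (dist u w))))

module BuildUp {k n : ℕ} (G₀ : Vec (Word n) k) (x : Word n) where

  ys : Vec Bool k
  ys = map (x ·_) G₀

  lower-rows : ∀ {j} (G : Vec (Word n) j) →
               map (λ r → (x · r) ∷ (x · r) ∷ r) G
                 ≡ zipWith _∷_ (map (x ·_) G) (zipWith _∷_ (map (x ·_) G) G)
  lower-rows []      = refl
  lower-rows (r ∷ G) = cong (_ ∷_) (lower-rows G)

  lift : ∀ {c} → Span G₀ c → Σ Bool λ y → Span (buildUp G₀ x) (y ∷ y ∷ c)
  lift {c} (α , c≡αG₀) = α · ys , (false ∷ α) , sym combination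
    where
    combination : lincomb (false ∷ α) (buildUp G₀ x) ≡ (α · ys) ∷ (α · ys) ∷ c
    combination = begin
      lincomb (false ∷ α) (buildUp G₀ x)
        ≡⟨ lincomb-false α (true ∷ false ∷ x) _ ⟩
      lincomb α (map (λ r → (x · r) ∷ (x · r) ∷ r) G₀)
        ≡⟨ cong (lincomb α) (lower-rows G₀) ⟩
      lincomb α (zipWith _∷_ ys (zipWith _∷_ ys G₀))
        ≡⟨ lincomb-adjoin α ys _ ⟩
      (α · ys) ∷ lincomb α (zipWith _∷_ ys G₀)
        ≡⟨ cong ((α · ys) ∷_) (lincomb-adjoin α ys G₀) ⟩
      (α · ys) ∷ (α · ys) ∷ lincomb α G₀
        ≡⟨ cong (λ w → (α · ys) ∷ (α · ys) ∷ w) (sym c≡αG₀) ⟩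
      (α · ys) ∷ (α · ys) ∷ c
        ∎

  covers : ∀ {R} → CoversWithin (Span G₀) R → CoversWithin (Span (buildUp G₀ x)) (R + 2)
  covers cov₁ (a ∷ b ∷ v) with cov₁ v
  ... | c , c∈C₁ , v~c with lift c∈C₁
  ...   | y , lifted∈C₂ =
    (y ∷ y ∷ c) , lifted∈C₂ ,
    ≤-trans (dist-prefix₂ a b y y v c) (+-monoˡ-≤ 2 v~c)

mainTheorem6 : (m : ℕ) (G₀ : Vec (Word (m + m)) m) (x : Word (m + m))
    → SelfDual (Span G₀)
    → wt x % 2 ≡ 1
    → (ρ₁ ρ₂ : ℕ)
    → IsCoveringRadius (Span G₀) ρ₁
    → IsCoveringRadius (Span (buildUp G₀ x)) ρ₂
    → ρ₂ ≤ ρ₁ + 2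
mainTheorem6 m G₀ x _ _ ρ₁ ρ₂ (covered₁ , _) (_ , minimal₂) =
  minimal₂ (ρ₁ + 2) (BuildUp.covers G₀ x covered₁)
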